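{- A collection $\mathcal C$ of languages is generatable in the limit with feedback if there exists a countable set of collections $\mathcal C_1,\mathcal C_2,\dots$ such that $\mathcal C=\bigcup_{i}\mathcal C_i$ and each $\mathcal C_i$ is uniformly generatable.
   Context: A language is an infinite subset of a countably infinite universe $U$; a collection is a set of languages. An enumeration of $K$ is an infinite sequence $x_0,x_1,\dots$ of pairwise distinct elements of $K$ containing every element of $K$; $S_t=\{x_0,\dots,x_t\}$. A collection $\mathcal D$ is uniformly generatable if there is a function $G$ from finite sequences in $U$ to $U$ and a time $t^\star$ such that for every $K\in\mathcal D$, every enumeration of $K$, and every $t\ge t^\star$, $G(x_0,\dots,x_t)\in K\setminus S_t$. Generation with feedback: at each time $t$ the adversary reveals $x_t$, the algorithm asks a membership query $y_t=G(x_0,a_0,\dots,a_{t-1},x_t)\in U$, receives $a_t\in\{\mathrm{Yes},\mathrm{No}\}$ indicating whether $y_t\in K$, and outputs $z_t=G(x_0,a_0,\dots,x_t,a_t)$; $\mathcal C$ is generatable in the limit with feedback if some such $G$ satisfies: for every $K\in\mathcal C$ and every enumeration of $K$ there is $t^\star$ with $z_t\in K\setminus S_t$ for all $t\ge t^\star$. -}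

module Defs where

open import Data.Nat using (ℕ; zero; suc; _≤_)
open import Data.Bool using (Bool; true; false)
open import Data.List using (List; []; _∷_; _++_; map; upTo)
open import Data.Product using (Σ; ∃; _×_; _,_)
open import Relation.Binary.PropositionalEquality using (_≡_; _≢_)

-- The countably infinite universe U is taken to be ℕ.
-- A subset of U is given by its characteristic function.
Subset : Set
Subset = ℕ → Bool

Infinite : Subset → Set
Infinite K = ∀ n → ∃ λ m → n ≤ m × K m ≡ true

Collection : Set₁
Collection = Subset → Set

IsCollection : Collection → Set
IsCollection C = ∀ K → C K → Infinite K

IsEnumeration : Subset → (ℕ → ℕ) → Set
IsEnumeration K x =
  (∀ s t → x s ≡ x t → s ≡ t) ×
  (∀ t → K (x t) ≡ true) ×
  (∀ k → K k ≡ true → ∃ λ t → x t ≡ k)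

prefix : (ℕ → ℕ) → ℕ → List ℕ
prefix x t = map x (upTo (suc t))

InKMinusS : Subset → (ℕ → ℕ) → ℕ → ℕ → Set
InKMinusS K x t z = K z ≡ true × (∀ s → s ≤ t → x s ≢ z)

UniformlyGeneratable : Collection → Set
UniformlyGeneratable D =
  Σ (List ℕ → ℕ) λ G → Σ ℕ λ tstar →
    ∀ K → D K → ∀ x → IsEnumeration K x →
      ∀ t → tstar ≤ t → InKMinusS K x t (G (prefix x t))

-- The history (x_0,a_0,...,x_{t-1},a_{t-1})
-- is a list of pairs; 'query' receives the history and x_t and returns y_t;
-- 'output' receives the history, x_t and a_t and returns z_t.
-- Answers: true = Yes, false = No.
record FeedbackGenerator : Set where
  field
    query  : List (ℕ × Bool) → ℕ → ℕ
    output : List (ℕ × Bool) → ℕ → Bool → ℕ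
open FeedbackGenerator public

history : FeedbackGenerator → Subset → (ℕ → ℕ) → ℕ → List (ℕ × Bool)
history G K x zero    = []
history G K x (suc t) =
  history G K x t ++ ((x t , K (query G (history G K x t) (x t))) ∷ [])

answer : FeedbackGenerator → Subset → (ℕ → ℕ) → ℕ → Bool
answer G K x t = K (query G (history G K x t) (x t))

outputAt : FeedbackGenerator → Subset → (ℕ → ℕ) → ℕ → ℕ
outputAt G K x t = output G (history G K x t) (x t) (answer G K x t)

GeneratableInTheLimitWithFeedback : Collection → Set
GeneratableInTheLimitWithFeedback C =
  Σ FeedbackGenerator λ G →
    ∀ K → C K → ∀ x → IsEnumeration K x →
      ∃ λ tstar → ∀ t → tstar ≤ t → InKMinusS K x t (outputAt G K x t)

-- Dovetail over the uniform generators G₀, G₁, … of the pieces Cᵢ. The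
-- generator keeps a current index j and asks whether the guess Gⱼ(x₀…xₜ) lies
-- in K; it outputs the guess if the answer is Yes and the guess has not been
-- enumerated yet, and the junk value 0 otherwise. Once t ≥ tⱼ⋆, a rejected
-- guess proves K ∉ Cⱼ, and only then is j advanced. Hence the index never
-- passes any i with K ∈ Cᵢ; being monotone and bounded it eventually settles
-- (this is where excluded middle is needed), and from then on every guess is
-- accepted, so every output lies in K ∖ Sₜ.
module Submission where

open import Defs
open import Level using (0ℓ)
open import Axiom.ExcludedMiddle using (ExcludedMiddle)
open import Data.Bool using (Bool; true; false; not; _∧_; if_then_else_)
open import Data.List using (List; []; [_]; _∷ʳ_; foldl; map; upTo; length)
open import Data.List.Properties using (foldl-∷ʳ; map-++; upTo-∷ʳ; length-map; length-upTo)
open import Data.List.Membership.Propositional using (_∈_; _∉_)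
open import Data.List.Membership.Propositional.Properties using (∈-map⁺; ∈-map⁻; ∈-upTo⁺; ∈-upTo⁻)
open import Data.Nat using (ℕ; zero; suc; _+_; _≤_; _≤ᵇ_; _≤′_; ≤′-refl; ≤′-step; _≟_; z≤n; s≤s)
open import Data.Nat.Properties
open import Data.List.Membership.DecPropositional _≟_ using (_∈?_)
open import Data.Product using (∃; _×_; _,_; proj₁; proj₂)
open import Data.Sum using (_⊎_; inj₁; inj₂)
open import Function.Bundles using (_⇔_; mk⇔; Equivalence)
open import Function.Construct.Composition using (_⇔-∘_)
open import Function.Construct.Symmetry using (⇔-sym)
open import Relation.Nullary using (yes; no; does; contradiction)
open import Relation.Nullary.Reflects using (ofʸ; ofⁿ)
open import Relation.Nullary.Decidable using (dec-false; decidable-stable)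
open import Relation.Binary.PropositionalEquality using (_≡_; _≢_; refl; sym; trans; cong; cong₂; subst)

≤-suc⇒monotone : {f : ℕ → ℕ} → (∀ t → f t ≤ f (suc t)) → ∀ {s t} → s ≤ t → f s ≤ f t
≤-suc⇒monotone {f} step s≤t = go (≤⇒≤′ s≤t)
  where
  go : ∀ {s t} → s ≤′ t → f s ≤ f t
  go ≤′-refl        = ≤-refl
  go (≤′-step s≤′t) = ≤-trans (go s≤′t) (step _)

bounded-monotone⇒stabilises : ExcludedMiddle 0ℓ → {f : ℕ → ℕ} →
  (∀ t → f t ≤ f (suc t)) → {b : ℕ} → (∀ t → f t ≤ b) →
  ∃ λ T → ∀ t → T ≤ t → f t ≡ f T
bounded-monotone⇒stabilises em {f} step {b} bounded = within b 0 (m≤m+n b (f 0))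
  where
  mono : ∀ {s t} → s ≤ t → f s ≤ f t
  mono = ≤-suc⇒monotone step

  -- m bounds the number of jumps f can still make after t₀.
  within : ∀ m t₀ → b ≤ m + f t₀ → ∃ λ T → ∀ t → T ≤ t → f t ≡ f T
  within zero t₀ b≤ft₀ = t₀ , λ t t₀≤t → ≤-antisym (≤-trans (bounded t) b≤ft₀) (mono t₀≤t)
  within (suc m) t₀ b≤ with em {∃ λ t → t₀ ≤ t × f t ≢ f t₀}
  ... | no ¬jump = t₀ , λ t t₀≤t → decidable-stable (f t ≟ f t₀) (λ ne → ¬jump (t , t₀≤t , ne))
  ... | yes (t₁ , t₀≤t₁ , ne) = within m t₁ (begin
      b                ≤⟨ b≤ ⟩
      suc m + f t₀     ≡⟨ +-suc m (f t₀) ⟨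
      m + suc (f t₀)   ≤⟨ +-monoʳ-≤ m (≤∧≢⇒< (mono t₀≤t₁) (λ e → ne (sym e))) ⟩
      m + f t₁         ∎)
    where open ≤-Reasoning

∈-prefix⇔ : ∀ {x t z} → z ∈ prefix x t ⇔ (∃ λ s → s ≤ t × x s ≡ z)
∈-prefix⇔ {x} {t} {z} = mk⇔ to from
  where
  to : z ∈ prefix x t → ∃ λ s → s ≤ t × x s ≡ z
  to z∈ with s , s∈ , refl ← ∈-map⁻ x z∈ = s , ≤-pred (∈-upTo⁻ s∈) , refl

  from : (∃ λ s → s ≤ t × x s ≡ z) → z ∈ prefix x t
  from (s , s≤t , refl) = ∈-map⁺ x (∈-upTo⁺ (s≤s s≤t))

InKMinusS⇔ : ∀ {K x t z} → InKMinusS K x t z ⇔ (K z ≡ true × z ∉ prefix x t)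
InKMinusS⇔ {K} {x} {t} {z} = mk⇔ to from
  where
  to : InKMinusS K x t z → K z ≡ true × z ∉ prefix x t
  to (z∈K , unseen) = z∈K , λ z∈S → let s , s≤t , xs≡z = Equivalence.to ∈-prefix⇔ z∈S in unseen s s≤t xs≡z

  from : K z ≡ true × z ∉ prefix x t → InKMinusS K x t z
  from (z∈K , z∉S) = z∈K , λ s s≤t xs≡z → z∉S (Equivalence.from ∈-prefix⇔ (s , s≤t , xs≡z))

map-upTo-∷ʳ : ∀ (x : ℕ → ℕ) t → map x (upTo t) ∷ʳ x t ≡ prefix x t
map-upTo-∷ʳ x t = trans (sym (map-++ x (upTo t) [ t ])) (cong (map x) (upTo-∷ʳ t))

fresh : List ℕ → ℕ → Bool → Bool
fresh p y a = a ∧ not (does (y ∈? p))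

fresh≡true⇔ : ∀ {p y a} → fresh p y a ≡ true ⇔ (a ≡ true × y ∉ p)
fresh≡true⇔ {p} {y} = mk⇔ to from
  where
  to : ∀ {a} → fresh p y a ≡ true → a ≡ true × y ∉ p
  to {true} e with y ∈? p
  ... | no y∉p = refl , y∉p
  to {false} ()

  from : ∀ {a} → a ≡ true × y ∉ p → fresh p y a ≡ true
  from (refl , y∉p) rewrite dec-false (y ∈? p) y∉p = refl

module Dovetail (G : ℕ → List ℕ → ℕ) (t⋆ : ℕ → ℕ) where

  -- The current index j and the elements x₀ … xₜ₋₁ enumerated so far.
  Config : Set
  Config = ℕ × List ℕ

  guess : Config → ℕ → ℕ
  guess (j , seen) x = G j (seen ∷ʳ x)

  advance : Config → ℕ × Bool → Config
  advance c@(j , seen) (x , a) = next , seen ∷ʳ x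
    where
    next : ℕ
    next = if (t⋆ j ≤ᵇ length seen) ∧ not (fresh (seen ∷ʳ x) (guess c x) a) then suc j else j

  emit : Config → ℕ → Bool → ℕ
  emit c@(_ , seen) x a = if fresh (seen ∷ʳ x) (guess c x) a then guess c x else 0

  config : List (ℕ × Bool) → Config
  config = foldl advance (0 , [])

  generator : FeedbackGenerator
  generator = record
    { query  = λ h → guess (config h)
    ; output = λ h → emit (config h)
    }

  module Run (K : Subset) (x : ℕ → ℕ) where

    state : ℕ → Config
    state t = config (history generator K x t)

    index : ℕ → ℕ
    index t = proj₁ (state t)

    guessAt : ℕ → ℕ
    guessAt t = G (index t) (prefix x t)

    accepted : ℕ → Bool
    accepted t = fresh (prefix x t) (guessAt t) (K (guessAt t))

    accepted⇔ : ∀ {t} → accepted t ≡ true ⇔ InKMinusS K x t (guessAt t)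
    accepted⇔ {t} = ⇔-sym (InKMinusS⇔ {K} {x} {t}) ⇔-∘ fresh≡true⇔

    state-suc : ∀ t → state (suc t) ≡ advance (state t) (x t , answer generator K x t)
    state-suc t = foldl-∷ʳ advance (0 , []) _ (history generator K x t)

    observed : ∀ t → proj₂ (state t) ∷ʳ x t ≡ prefix x t

    seen-state : ∀ t → proj₂ (state t) ≡ map x (upTo t)
    seen-state zero    = refl
    seen-state (suc t) = trans (cong proj₂ (state-suc t)) (observed t)

    observed t = trans (cong (_∷ʳ x t) (seen-state t)) (map-upTo-∷ʳ x t)

    length-seen : ∀ t → length (proj₂ (state t)) ≡ t
    length-seen t = trans (cong length (seen-state t)) (trans (length-map x (upTo t)) (length-upTo t))

    index-suc : ∀ t → index (suc t) ≡
      (if (t⋆ (index t) ≤ᵇ t) ∧ not (accepted t) then suc (index t) else index t)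
    index-suc t = trans (cong proj₁ (state-suc t)) (cong₂ next (length-seen t) (observed t))
      where
      next : ℕ → List ℕ → ℕ
      next n p = if (t⋆ (index t) ≤ᵇ n) ∧ not (fresh p (G (index t) p) (K (G (index t) p)))
                 then suc (index t) else index t

    outputAt-accepted : ∀ t → accepted t ≡ true → outputAt generator K x t ≡ guessAt t
    outputAt-accepted t acc = trans (cong out (observed t)) (cong (λ b → if b then guessAt t else 0) acc)
      where
      out : List ℕ → ℕ
      out p = if fresh p (G (index t) p) (K (G (index t) p)) then G (index t) p else 0

    index-rejected : ∀ t → t⋆ (index t) ≤ t → accepted t ≡ false → index (suc t) ≡ suc (index t)
    index-rejected t t⋆≤t rej with t⋆ (index t) ≤ᵇ t | ≤ᵇ-reflects-≤ (t⋆ (index t)) t | accepted t | index-suc t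
    ... | true  | _         | false | eq = eq
    ... | false | ofⁿ t⋆≰t | _     | _  = contradiction t⋆≤t t⋆≰t

    index-step : ∀ t → index (suc t) ≡ index t
                     ⊎ (t⋆ (index t) ≤ t × accepted t ≡ false × index (suc t) ≡ suc (index t))
    index-step t with t⋆ (index t) ≤ᵇ t | ≤ᵇ-reflects-≤ (t⋆ (index t)) t | accepted t | index-suc t
    ... | true  | ofʸ t⋆≤t | false | eq = inj₂ (t⋆≤t , refl , eq)
    ... | true  | _        | true  | eq = inj₁ eq
    ... | false | _        | _     | eq = inj₁ eq

    index-≤-suc : ∀ t → index t ≤ index (suc t)
    index-≤-suc t with index-step t
    ... | inj₁ same              = ≤-reflexive (sym same)
    ... | inj₂ (_ , _ , raised) = ≤-trans (n≤1+n (index t)) (≤-reflexive (sym raised))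

    index-bounded : ∀ {j} → (∀ t → t⋆ j ≤ t → InKMinusS K x t (G j (prefix x t))) →
                    ∀ t → index t ≤ j
    index-bounded correct zero = z≤n
    index-bounded {j} correct (suc t) with index-step t
    ... | inj₁ same = ≤-trans (≤-reflexive same) (index-bounded correct t)
    ... | inj₂ (t⋆≤t , rejected , raised) =
      ≤-trans (≤-reflexive raised) (≤∧≢⇒< (index-bounded correct t) index≢j)
      where
      index≢j : index t ≢ j
      index≢j refl = contradiction (trans (sym (Equivalence.from accepted⇔ (correct t t⋆≤t))) rejected) λ ()

    correct-once-settled : ∀ t → t⋆ (index t) ≤ t → index (suc t) ≡ index t →
                           InKMinusS K x t (outputAt generator K x t)
    correct-once-settled t t⋆≤t settled with accepted t in acc
    ... | true  = subst (InKMinusS K x t) (sym (outputAt-accepted t acc)) (Equivalence.to accepted⇔ acc)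
    ... | false = contradiction (trans (sym (index-rejected t t⋆≤t acc)) settled) 1+n≢n

    eventually-correct : ExcludedMiddle 0ℓ → ∀ {j} →
      (∀ t → t⋆ j ≤ t → InKMinusS K x t (G j (prefix x t))) →
      ∃ λ t₀ → ∀ t → t₀ ≤ t → InKMinusS K x t (outputAt generator K x t)
    eventually-correct em correct
      with T , constant ← bounded-monotone⇒stabilises em index-≤-suc (index-bounded correct) =
      T + t⋆ (index T) , λ t T+t⋆≤t →
        let T≤t = ≤-trans (m≤m+n T _) T+t⋆≤t
            index-t≡index-T = constant t T≤t
        in correct-once-settled t
             (subst (_≤ t) (cong t⋆ (sym index-t≡index-T)) (≤-trans (m≤n+m _ T) T+t⋆≤t))
             (trans (constant (suc t) (m≤n⇒m≤1+n T≤t)) (sym index-t≡index-T))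

theorem6p1 : ExcludedMiddle 0ℓ →
    (C : Collection) → IsCollection C →
    (Cs : ℕ → Collection) → (∀ i → IsCollection (Cs i)) →
    (∀ K → C K ⇔ (∃ λ i → Cs i K)) →
    (∀ i → UniformlyGeneratable (Cs i)) →
    GeneratableInTheLimitWithFeedback C
theorem6p1 em C _ Cs _ C⇔⋃Cs uniform = generator , generates
  where
  open Dovetail (λ i → proj₁ (uniform i)) (λ i → proj₁ (proj₂ (uniform i)))

  generates : ∀ K → C K → ∀ x → IsEnumeration K x →
              ∃ λ t₀ → ∀ t → t₀ ≤ t → InKMinusS K x t (outputAt generator K x t)
  generates K K∈C x enum with i , K∈Cᵢ ← Equivalence.to (C⇔⋃Cs K) K∈C =
    Run.eventually-correct K x em (proj₂ (proj₂ (uniform i)) K K∈Cᵢ x enum)
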